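{- The theory $\mathsf{TC}_1$ together with Left Cancellation and Right Cancellation does not prove Bi-Cancellation, i.e. $\forall x,u,v\,(x=u*x*v\to(u=\varnothing\wedge v=\varnothing))$.
   Context: $\mathsf{TC}_1$ is the theory in the language with a constant $\varnothing$ and binary function $*$, axiomatised by: $\varnothing*x=x\wedge x*\varnothing=x$; $x*y=\varnothing\to(x=\varnothing\wedge y=\varnothing)$; $(x*y)*z=x*(y*z)$; and $x*y=u*v\to\exists w\,((x*w=u\wedge y=w*v)\vee(x=u*w\wedge w*y=v))$. Left Cancellation: $x*y=x*z\to y=z$. Right Cancellation: $x*z=y*z\to x=y$. -}

module Defs where

open import Level using (Level; suc)
open import Data.Product using (Σ; ∃; _×_; _,_)
open import Data.Sum using (_⊎_)
open import Relation.Nullary using (¬_)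
open import Relation.Binary.PropositionalEquality using (_≡_)

-- A structure for the language {∅, *}: carrier, constant, binary function.
-- Equality of the first-order language is interpreted as _≡_.
record Structure (ℓ : Level) : Set (suc ℓ) where
  field
    Carrier : Set ℓ
    ∅       : Carrier
    _*_     : Carrier → Carrier → Carrier
  infixl 7 _*_

record IsTC₁ {ℓ : Level} (M : Structure ℓ) : Set ℓ where
  open Structure M
  field
    identityˡ  : ∀ x → ∅ * x ≡ x
    identityʳ  : ∀ x → x * ∅ ≡ x
    nonTrivial : ∀ x y → x * y ≡ ∅ → (x ≡ ∅ × y ≡ ∅)
    assoc      : ∀ x y z → (x * y) * z ≡ x * (y * z)
    editor     : ∀ x y u v → x * y ≡ u * v →
                 ∃ λ w → ((x * w ≡ u × y ≡ w * v) ⊎ (x ≡ u * w × w * y ≡ v))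

module _ {ℓ : Level} (M : Structure ℓ) where
  open Structure M

  LeftCancellation : Set ℓ
  LeftCancellation = ∀ x y z → x * y ≡ x * z → y ≡ z

  RightCancellation : Set ℓ
  RightCancellation = ∀ x y z → x * z ≡ y * z → x ≡ y

  -- u * x * v parses as (u * x) * v (irrelevant by associativity)
  BiCancellation : Set ℓ
  BiCancellation = ∀ x u v → x ≡ u * x * v → (u ≡ ∅ × v ≡ ∅)

-- "TC₁ + LC + RC does not prove BC": witnessed (via soundness) by a model of
-- TC₁ + LC + RC in which BC fails.
NotProvableBiCancellation : (ℓ : Level) → Set (suc ℓ)
NotProvableBiCancellation ℓ =
  Σ (Structure ℓ) λ M →
    IsTC₁ M × LeftCancellation M × RightCancellation M × ¬ BiCancellation M

{-# OPTIONS --safe #-}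

-- The counter-model is a submonoid of the Klein bottle group ⟨a, t ∣ t a t⁻¹ = a⁻¹⟩,
-- namely the elements aᵐ tⁿ with n > 0 or m ≥ 0. Being inside a group it is
-- cancellative; it has no non-trivial units; and any two of its elements are
-- comparable in the prefix order, which together with left cancellation gives the
-- editor axiom. Bi-cancellation fails because a t a = t a⁻¹ a = t.

module Submission where

open import Defs
open import Level using (Level; 0ℓ)
open import Data.Nat as ℕ using (ℕ; zero; suc; _∸_; compare; less; equal; greater)
import Data.Nat.Properties as ℕₚ
open import Data.Integer using (ℤ; +_; -[1+_]; _+_; -_)
import Data.Integer.Properties as ℤₚ
open import Algebra.Properties.AbelianGroup ℤₚ.+-0-abelianGroup
  using (∙-cancelˡ; ∙-cancelʳ; \\-leftDividesˡ; ⁻¹-anti-homo-\\)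
open import Data.Product using (∃; _×_; _,_; proj₁; proj₂)
open import Data.Sum using (_⊎_; inj₁; inj₂)
open import Relation.Binary.PropositionalEquality
open import Relation.Nullary using (¬_)
open import Function using (_∘_)

module _ {ℓ : Level} (M : Structure ℓ) where
  open Structure M

  PrefixTotal : Set ℓ
  PrefixTotal = ∀ x u → ∃ λ w → x * w ≡ u ⊎ x ≡ u * w

  prefixTotal⇒editor : (∀ x y z → (x * y) * z ≡ x * (y * z)) →
                       LeftCancellation M → PrefixTotal →
                       ∀ x y u v → x * y ≡ u * v →
                       ∃ λ w → ((x * w ≡ u × y ≡ w * v) ⊎ (x ≡ u * w × w * y ≡ v))
  prefixTotal⇒editor assoc cancelˡ total x y u v xy≡uv with total x u
  ... | w , inj₁ xw≡u = w , inj₁ (xw≡u , cancelˡ x y (w * v) (begin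
    x * y        ≡⟨ xy≡uv ⟩
    u * v        ≡⟨ cong (_* v) xw≡u ⟨
    x * w * v    ≡⟨ assoc x w v ⟩
    x * (w * v)  ∎))
    where open ≡-Reasoning
  ... | w , inj₂ x≡uw = w , inj₂ (x≡uw , cancelˡ u (w * y) v (begin
    u * (w * y)  ≡⟨ assoc u w y ⟨
    u * w * y    ≡⟨ cong (_* y) x≡uw ⟨
    x * y        ≡⟨ xy≡uv ⟩
    u * v        ∎))
    where open ≡-Reasoning

twist : ℕ → ℤ → ℤ
twist zero    i = i
twist (suc n) i = - twist n i

twist-+0 : ∀ n → twist n (+ 0) ≡ + 0
twist-+0 zero    = refl
twist-+0 (suc n) = cong -_ (twist-+0 n)

twist-distrib-+ : ∀ n i j → twist n (i + j) ≡ twist n i + twist n j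
twist-distrib-+ zero    i j = refl
twist-distrib-+ (suc n) i j =
  trans (cong -_ (twist-distrib-+ n i j)) (ℤₚ.neg-distrib-+ (twist n i) (twist n j))

twist-neg : ∀ n i → twist n (- i) ≡ - twist n i
twist-neg zero    i = refl
twist-neg (suc n) i = cong -_ (twist-neg n i)

twist-+ : ∀ m n i → twist (m ℕ.+ n) i ≡ twist m (twist n i)
twist-+ zero    n i = refl
twist-+ (suc m) n i = cong -_ (twist-+ m n i)

twist-involutive : ∀ n i → twist n (twist n i) ≡ i
twist-involutive zero    i = refl
twist-involutive (suc n) i = begin
  - twist n (- twist n i)  ≡⟨ cong -_ (twist-neg n (twist n i)) ⟩
  - - twist n (twist n i)  ≡⟨ ℤₚ.neg-involutive _ ⟩
  twist n (twist n i)      ≡⟨ twist-involutive n i ⟩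
  i                        ∎
  where open ≡-Reasoning

twist-injective : ∀ n {i j} → twist n i ≡ twist n j → i ≡ j
twist-injective n {i} {j} eq = begin
  i                    ≡⟨ twist-involutive n i ⟨
  twist n (twist n i)  ≡⟨ cong (twist n) eq ⟩
  twist n (twist n j)  ≡⟨ twist-involutive n j ⟩
  j                    ∎
  where open ≡-Reasoning

m+twist[-m+i]≡i : ∀ n m i → m + twist n (twist n (- m + i)) ≡ i
m+twist[-m+i]≡i n m i = trans (cong (_+_ m) (twist-involutive n _)) (\\-leftDividesˡ m i)

-- (m , n) stands for aᵐ tⁿ.
Klein : Set
Klein = ℤ × ℕ

infixl 7 _·_
_·_ : Klein → Klein → Klein
(m , n) · (m′ , n′) = m + twist n m′ , n ℕ.+ n′

·-assoc : ∀ x y z → (x · y) · z ≡ x · (y · z)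
·-assoc (m , n) (m′ , n′) (m″ , n″) = cong₂ _,_ eq (ℕₚ.+-assoc n n′ n″)
  where
  open ≡-Reasoning
  eq : m + twist n m′ + twist (n ℕ.+ n′) m″ ≡ m + twist n (m′ + twist n′ m″)
  eq = begin
    m + twist n m′ + twist (n ℕ.+ n′) m″     ≡⟨ cong (_+_ (m + twist n m′)) (twist-+ n n′ m″) ⟩
    m + twist n m′ + twist n (twist n′ m″)   ≡⟨ ℤₚ.+-assoc m _ _ ⟩
    m + (twist n m′ + twist n (twist n′ m″)) ≡⟨ cong (_+_ m) (twist-distrib-+ n m′ _) ⟨
    m + twist n (m′ + twist n′ m″)           ∎

·-cancelˡ : ∀ x y z → x · y ≡ x · z → y ≡ z
·-cancelˡ (m , n) (i , p) (j , q) eq = cong₂ _,_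
  (twist-injective n (∙-cancelˡ m _ _ (cong proj₁ eq)))
  (ℕₚ.+-cancelˡ-≡ n p q (cong proj₂ eq))

·-cancelʳ : ∀ x y z → x · z ≡ y · z → x ≡ y
·-cancelʳ (m , n) (m′ , n′) (i , p) eq with ℕₚ.+-cancelʳ-≡ p n n′ (cong proj₂ eq)
... | refl = cong (_, n) (∙-cancelʳ (twist n i) m m′ (cong proj₁ eq))

-- untwisted a = aᵃ and twisted m k = aᵐ tᵏ⁺¹.
data Cone : Set where
  untwisted : ℕ → Cone
  twisted   : ℤ → ℕ → Cone

ι : Cone → Klein
ι (untwisted a) = + a , 0
ι (twisted m k) = m , suc k

ι-injective : ∀ {x y} → ι x ≡ ι y → x ≡ y
ι-injective {untwisted a} {untwisted .a} refl = refl
ι-injective {twisted m k} {twisted .m .k} refl = refl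

infixl 7 _⋆_
_⋆_ : Cone → Cone → Cone
untwisted a ⋆ untwisted b  = untwisted (a ℕ.+ b)
untwisted a ⋆ twisted m k  = twisted (+ a + m) k
twisted m k ⋆ untwisted b  = twisted (m + twist (suc k) (+ b)) k
twisted m k ⋆ twisted m′ k′ = twisted (m + twist (suc k) m′) (k ℕ.+ suc k′)

ι-homo : ∀ x y → ι (x ⋆ y) ≡ ι x · ι y
ι-homo (untwisted a) (untwisted b) = cong (_, 0) (ℤₚ.pos-+ a b)
ι-homo (untwisted a) (twisted m k) = refl
ι-homo (twisted m k) (untwisted b) = cong (m + twist (suc k) (+ b) ,_) (sym (ℕₚ.+-identityʳ (suc k)))
ι-homo (twisted m k) (twisted m′ k′) = refl

⋆-assoc : ∀ x y z → (x ⋆ y) ⋆ z ≡ x ⋆ (y ⋆ z)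
⋆-assoc x y z = ι-injective (begin
  ι ((x ⋆ y) ⋆ z)    ≡⟨ ι-homo (x ⋆ y) z ⟩
  ι (x ⋆ y) · ι z    ≡⟨ cong (_· ι z) (ι-homo x y) ⟩
  (ι x · ι y) · ι z  ≡⟨ ·-assoc (ι x) (ι y) (ι z) ⟩
  ι x · (ι y · ι z)  ≡⟨ cong (ι x ·_) (ι-homo y z) ⟨
  ι x · ι (y ⋆ z)    ≡⟨ ι-homo x (y ⋆ z) ⟨
  ι (x ⋆ (y ⋆ z))    ∎)
  where open ≡-Reasoning

⋆-cancelˡ : ∀ x y z → x ⋆ y ≡ x ⋆ z → y ≡ z
⋆-cancelˡ x y z eq = ι-injective (·-cancelˡ (ι x) (ι y) (ι z)
  (trans (sym (ι-homo x y)) (trans (cong ι eq) (ι-homo x z))))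

⋆-cancelʳ : ∀ x y z → x ⋆ z ≡ y ⋆ z → x ≡ y
⋆-cancelʳ x y z eq = ι-injective (·-cancelʳ (ι x) (ι y) (ι z)
  (trans (sym (ι-homo x z)) (trans (cong ι eq) (ι-homo y z))))

⋆-identityˡ : ∀ x → untwisted 0 ⋆ x ≡ x
⋆-identityˡ (untwisted b) = refl
⋆-identityˡ (twisted m k) = cong (λ i → twisted i k) (ℤₚ.+-identityˡ m)

⋆-identityʳ : ∀ x → x ⋆ untwisted 0 ≡ x
⋆-identityʳ (untwisted a) = cong untwisted (ℕₚ.+-identityʳ a)
⋆-identityʳ (twisted m k) =
  cong (λ i → twisted i k) (trans (cong (_+_ m) (twist-+0 (suc k))) (ℤₚ.+-identityʳ m))

⋆-zeroFree : ∀ x y → x ⋆ y ≡ untwisted 0 → x ≡ untwisted 0 × y ≡ untwisted 0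
⋆-zeroFree (untwisted a) (untwisted b) eq =
  cong untwisted (ℕₚ.m+n≡0⇒m≡0 a a+b≡0) , cong untwisted (ℕₚ.m+n≡0⇒n≡0 a a+b≡0)
  where
  a+b≡0 : a ℕ.+ b ≡ 0
  a+b≡0 = ℤₚ.+-injective (cong (proj₁ ∘ ι) eq)
⋆-zeroFree (untwisted a) (twisted m k)  ()
⋆-zeroFree (twisted m k) (untwisted b)  ()
⋆-zeroFree (twisted m k) (twisted m′ k′) ()

twisted⋆untwisted≡twisted : ∀ m m′ k {j} → twist (suc k) (- m + m′) ≡ + j →
                            twisted m k ⋆ untwisted j ≡ twisted m′ k
twisted⋆untwisted≡twisted m m′ k eq = cong (λ i → twisted i k)
  (trans (cong (λ i → m + twist (suc k) i) (sym eq)) (m+twist[-m+i]≡i (suc k) m m′))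

-- Twisted elements of equal t-degree differ by a power of a, whose sign decides
-- which one is the prefix.
twisted-prefixTotal : ∀ m m′ k →
  ∃ λ w → twisted m k ⋆ w ≡ twisted m′ k ⊎ twisted m k ≡ twisted m′ k ⋆ w
twisted-prefixTotal m m′ k with twist (suc k) (- m + m′) in eq
... | + j      = untwisted j , inj₁ (twisted⋆untwisted≡twisted m m′ k eq)
... | -[1+ j ] = untwisted (suc j) , inj₂ (sym (twisted⋆untwisted≡twisted m′ m k eq′))
  where
  open ≡-Reasoning
  eq′ : twist (suc k) (- m′ + m) ≡ + suc j
  eq′ = begin
    twist (suc k) (- m′ + m)       ≡⟨ cong (twist (suc k)) (⁻¹-anti-homo-\\ m m′) ⟨
    twist (suc k) (- (- m + m′))   ≡⟨ twist-neg (suc k) (- m + m′) ⟩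
    - twist (suc k) (- m + m′)     ≡⟨ cong -_ eq ⟩
    + suc j                        ∎

cone : Structure 0ℓ
cone = record { Carrier = Cone ; ∅ = untwisted 0 ; _*_ = _⋆_ }

⋆-prefixTotal : PrefixTotal cone
⋆-prefixTotal (untwisted a) (untwisted c) with ℕₚ.≤-total a c
... | inj₁ a≤c = untwisted (c ∸ a) , inj₁ (cong untwisted (ℕₚ.m+[n∸m]≡n a≤c))
... | inj₂ c≤a = untwisted (a ∸ c) , inj₂ (cong untwisted (sym (ℕₚ.m+[n∸m]≡n c≤a)))
⋆-prefixTotal (untwisted a) (twisted m k) =
  twisted (- + a + m) k , inj₁ (cong (λ i → twisted i k) (\\-leftDividesˡ (+ a) m))
⋆-prefixTotal (twisted m k) (untwisted c) =
  twisted (- + c + m) k , inj₂ (cong (λ i → twisted i k) (sym (\\-leftDividesˡ (+ c) m)))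
⋆-prefixTotal (twisted m k) (twisted m′ k′) with compare k k′
... | less .k d = twisted (twist (suc k) (- m + m′)) d ,
  inj₁ (cong₂ twisted (m+twist[-m+i]≡i (suc k) m m′) (ℕₚ.+-suc k d))
... | greater .k′ d = twisted (twist (suc k′) (- m′ + m)) d ,
  inj₂ (sym (cong₂ twisted (m+twist[-m+i]≡i (suc k′) m′ m) (ℕₚ.+-suc k′ d)))
... | equal .k = twisted-prefixTotal m m′ k

cone-isTC₁ : IsTC₁ cone
cone-isTC₁ = record
  { identityˡ  = ⋆-identityˡ
  ; identityʳ  = ⋆-identityʳ
  ; nonTrivial = ⋆-zeroFree
  ; assoc      = ⋆-assoc
  ; editor     = prefixTotal⇒editor cone ⋆-assoc ⋆-cancelˡ ⋆-prefixTotal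
  }

cone-¬biCancellation : ¬ BiCancellation cone
cone-¬biCancellation biCancel with biCancel (twisted (+ 0) 0) (untwisted 1) (untwisted 1) refl
... | () , _

mainTheorem8 : NotProvableBiCancellation 0ℓ
mainTheorem8 = cone , cone-isTC₁ , ⋆-cancelˡ , ⋆-cancelʳ , cone-¬biCancellation
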